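{- Let $n$ be a positive integer, let $f:\{0,1\}^n\to\{0,1\}$ be a monotone Boolean function, and let $L\in GL_n(\mathbb{F}_2)$. Define $Lf:\{0,1\}^n\to\{0,1\}$ by $Lf(x)=f(Lx)$. Then $I(f)\le I(Lf)$.
   Context: Elements of $\{0,1\}^n$ are identified with vectors in $\mathbb{F}_2^n$; addition is coordinatewise modulo $2$, and $Lx$ is the matrix-vector product over $\mathbb{F}_2$. A Boolean function $f:\{0,1\}^n\to\{0,1\}$ is monotone if $f(x)\le f(y)$ whenever $x_i\le y_i$ for all $1\le i\le n$. Let $e_i$ be the vector whose only nonzero coordinate is the $i$-th. The influence of the $i$-th variable on $f$ is $I_i(f)=\frac{1}{2^n}\sum_{x\in\{0,1\}^n}|f(x+e_i)-f(x)|$, and the total influence is $I(f)=\sum_{i=1}^n I_i(f)$. -}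

module Defs where

open import Data.Bool using (Bool; true; false; _xor_; _∧_; if_then_else_)
open import Data.Nat using (ℕ; zero; suc; _+_; _^_)
open import Data.Nat.Properties using ()
open import Data.Fin using (Fin; _≟_)
open import Data.Vec using (Vec; []; _∷_; lookup; tabulate; map; zipWith; foldr; allFin)
open import Data.List using (List; []; _∷_; _++_) renaming (map to lmap)
open import Data.Nat.ListAction using (sum)
open import Data.Product using (Σ; _×_)
open import Relation.Nullary using (does)
open import Relation.Binary.PropositionalEquality using (_≡_)
open import Data.Rational.Unnormalised using (ℚᵘ; mkℚᵘ; _≤_)
open import Data.Integer using (+_)

-- Points of {0,1}^n, identified with F_2^n (true = 1, false = 0).
Cube : ℕ → Set
Cube n = Vec Bool n

_⊕_ : ∀ {n} → Cube n → Cube n → Cube n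
_⊕_ = zipWith _xor_

e : ∀ {n} → Fin n → Cube n
e i = tabulate (λ j → does (j ≟ i))

_≤b_ : Bool → Bool → Set
false ≤b _ = Data.Unit.⊤ where import Data.Unit
true ≤b false = Data.Empty.⊥ where import Data.Empty
true ≤b true = Data.Unit.⊤ where import Data.Unit

_≼_ : ∀ {n} → Cube n → Cube n → Set
_≼_ {n} x y = (i : Fin n) → lookup x i ≤b lookup y i

Monotone : ∀ {n} → (Cube n → Bool) → Set
Monotone {n} f = (x y : Cube n) → x ≼ y → f x ≤b f y

-- n×n matrices over F_2, as vectors of rows.
Mat : ℕ → Set
Mat n = Vec (Vec Bool n) n

dot : ∀ {n} → Vec Bool n → Vec Bool n → Bool
dot u v = foldr _ _xor_ false (zipWith _∧_ u v)

_·_ : ∀ {n} → Mat n → Cube n → Cube n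
L · x = map (λ row → dot row x) L

_*ᴹ_ : ∀ {n} → Mat n → Mat n → Mat n
_*ᴹ_ {n} A B = map (λ row → tabulate (λ j → dot row (map (λ r → lookup r j) B))) A

idMat : ∀ {n} → Mat n
idMat = tabulate e

InGL : ∀ {n} → Mat n → Set
InGL {n} L = Σ (Mat n) (λ M → (M *ᴹ L ≡ idMat) × (L *ᴹ M ≡ idMat))

allCube : (n : ℕ) → List (Cube n)
allCube zero = [] ∷ []
allCube (suc n) = lmap (false ∷_) (allCube n) ++ lmap (true ∷_) (allCube n)

absDiff : Bool → Bool → ℕ
absDiff a b = if a xor b then 1 else 0

-- 2^n · I_i(f) = Σ_x |f(x+e_i) - f(x)|.
influenceCount : ∀ {n} → (Cube n → Bool) → Fin n → ℕ
influenceCount {n} f i = sum (lmap (λ x → absDiff (f (x ⊕ e i)) (f x)) (allCube n))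

influence : ∀ {n} → (Cube n → Bool) → Fin n → ℚᵘ
influence {n} f i = mkℚᵘ (+ influenceCount f i) (2 ^ n Data.Nat.∸ 1)
  where import Data.Nat

-- mkℚᵘ p q denotes p / (suc q), so the denominator above is 2^n.

totalInfluence : ∀ {n} → (Cube n → Bool) → ℚᵘ
totalInfluence {n} f =
  Data.Vec.foldr _ Data.Rational.Unnormalised._+_ Data.Rational.Unnormalised.0ℚᵘ
    (map (influence f) (allFin n))
  where import Data.Rational.Unnormalised

applyLin : ∀ {n} → Mat n → (Cube n → Bool) → Cube n → Bool
applyLin L f x = f (L · x)

-- Write 2ⁿ I_i(Lf) as the number of x with f(x ⊕ L eᵢ) ≠ f(x): the influence of f in the direction
-- of the i-th column of L. For monotone f the influence in any direction v with v_j = 1 is at least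
-- the influence in direction e_j, because on the half-cube x_j = 1 monotonicity makes e_j the
-- direction along which f changes least. Since L is invertible, every set S of rows of L meets at
-- least |S| columns (Hall's condition: x ↦ N ∩ M x embeds the subsets of S into those of the
-- neighbourhood N), and a layer-cake argument turns this into Σ_j I_j(f) ≤ Σ_i I_{L eᵢ}(f).
module Submission where

open import Defs
open import Algebra.Bundles using (CommutativeRing)
import Algebra.Properties.CommutativeMonoid.Sum as CommutativeMonoidSum
import Algebra.Properties.CommutativeSemigroup as CommutativeSemigroupProperties
open import Data.Bool using (Bool; true; false; not; _∧_; _xor_; if_then_else_; T)
import Data.Bool.Properties as Boolₚ
open import Data.Fin using (Fin; zero; suc)
import Data.Fin.Properties as Finₚ
open Finₚ using (any?)
open import Data.Fin.Subset using (Subset; _⊆_; _∩_; ∣_∣)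
open import Data.Fin.Subset.Properties using (_⊆?_; p⊆q⇒∣p∣≤∣q∣; p∩q⊆p; drop-∷-⊆)
open import Data.Product using (∃; _×_; _,_)
open import Data.List using (_++_) renaming (map to mapᴸ)
import Data.List.Properties as Listₚ
open import Data.Nat using (ℕ; zero; suc; _+_; _*_; _∸_; _^_; _≤_; _<ᵇ_; z≤n; s≤s; NonZero)
import Data.Nat.Properties as ℕₚ
open import Data.Nat.Logarithm using (⌊log₂⌋-mono-≤; ⌊log₂[2^n]⌋≡n)
open import Data.Nat.ListAction using (sum)
open import Data.Nat.ListAction.Properties using (sum-++)
open import Data.Vec using (Vec; []; _∷_; lookup; tabulate; map; foldr; here)
import Data.Vec.Properties as Vecₚ
import Data.Integer as ℤ
import Data.Integer.Properties as ℤₚ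
import Data.Rational.Unnormalised as ℚ
open import Data.Rational.Unnormalised using (mkℚᵘ; 0ℚᵘ; _≃_; *≡*; *≤*)
import Data.Rational.Unnormalised.Properties as ℚₚ
open import Function using (_∘_; case_of_)
open import Relation.Nullary using (Dec; does; yes; no; contradiction)
open import Relation.Nullary.Decidable using (dec-true; T?)
open import Relation.Binary.PropositionalEquality

open CommutativeMonoidSum ℕₚ.+-0-commutativeMonoid using (sum-syntax; sum-cong-≗; ∑-distrib-+; sum-replicate-zero)
open CommutativeSemigroupProperties ℕₚ.+-commutativeSemigroup using () renaming (interchange to +-interchange)

-- Sums over the cube

𝟙 : Bool → ℕ
𝟙 true = 1
𝟙 false = 0

cubeSum : (n : ℕ) → (Cube n → ℕ) → ℕ
cubeSum zero h = h []
cubeSum (suc n) h = cubeSum n (h ∘ (false ∷_)) + cubeSum n (h ∘ (true ∷_))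

sum-allCube : ∀ n (h : Cube n → ℕ) → sum (mapᴸ h (allCube n)) ≡ cubeSum n h
sum-allCube zero h = ℕₚ.+-identityʳ (h [])
sum-allCube (suc n) h = begin
  sum (mapᴸ h (mapᴸ (false ∷_) xs ++ mapᴸ (true ∷_) xs))
    ≡⟨ cong sum (Listₚ.map-++ h (mapᴸ (false ∷_) xs) _) ⟩
  sum (mapᴸ h (mapᴸ (false ∷_) xs) ++ mapᴸ h (mapᴸ (true ∷_) xs))
    ≡⟨ sum-++ (mapᴸ h (mapᴸ (false ∷_) xs)) _ ⟩
  sum (mapᴸ h (mapᴸ (false ∷_) xs)) + sum (mapᴸ h (mapᴸ (true ∷_) xs))
    ≡⟨ cong₂ _+_ (cong sum (sym (Listₚ.map-∘ xs))) (cong sum (sym (Listₚ.map-∘ xs))) ⟩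
  sum (mapᴸ (h ∘ (false ∷_)) xs) + sum (mapᴸ (h ∘ (true ∷_)) xs)
    ≡⟨ cong₂ _+_ (sum-allCube n _) (sum-allCube n _) ⟩
  cubeSum (suc n) h ∎
  where
  open ≡-Reasoning
  xs = allCube n

cubeSum-cong : ∀ n {g h : Cube n → ℕ} → g ≗ h → cubeSum n g ≡ cubeSum n h
cubeSum-cong zero g≗h = g≗h []
cubeSum-cong (suc n) g≗h = cong₂ _+_ (cubeSum-cong n (g≗h ∘ (false ∷_))) (cubeSum-cong n (g≗h ∘ (true ∷_)))

cubeSum-mono-≤ : ∀ n {g h : Cube n → ℕ} → (∀ x → g x ≤ h x) → cubeSum n g ≤ cubeSum n h
cubeSum-mono-≤ zero g≤h = g≤h []
cubeSum-mono-≤ (suc n) g≤h = ℕₚ.+-mono-≤ (cubeSum-mono-≤ n (g≤h ∘ (false ∷_))) (cubeSum-mono-≤ n (g≤h ∘ (true ∷_)))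

cubeSum-distrib-+ : ∀ n (g h : Cube n → ℕ) → cubeSum n (λ x → g x + h x) ≡ cubeSum n g + cubeSum n h
cubeSum-distrib-+ zero g h = refl
cubeSum-distrib-+ (suc n) g h = begin
  cubeSum n (λ x → g (false ∷ x) + h (false ∷ x)) + cubeSum n (λ x → g (true ∷ x) + h (true ∷ x))
    ≡⟨ cong₂ _+_ (cubeSum-distrib-+ n _ _) (cubeSum-distrib-+ n _ _) ⟩
  (cubeSum n (g ∘ (false ∷_)) + cubeSum n (h ∘ (false ∷_))) + (cubeSum n (g ∘ (true ∷_)) + cubeSum n (h ∘ (true ∷_)))
    ≡⟨ +-interchange (cubeSum n (g ∘ (false ∷_))) _ _ _ ⟩
  cubeSum (suc n) g + cubeSum (suc n) h ∎
  where open ≡-Reasoning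

cubeSum-zero : ∀ n → cubeSum n (λ _ → 0) ≡ 0
cubeSum-zero zero = refl
cubeSum-zero (suc n) = cong₂ _+_ (cubeSum-zero n) (cubeSum-zero n)

cubeSum-comm : ∀ m n (G : Cube m → Cube n → ℕ) →
  cubeSum m (λ x → cubeSum n (G x)) ≡ cubeSum n (λ y → cubeSum m (λ x → G x y))
cubeSum-comm zero n G = refl
cubeSum-comm (suc m) n G = begin
  cubeSum m (λ x → cubeSum n (G (false ∷ x))) + cubeSum m (λ x → cubeSum n (G (true ∷ x)))
    ≡⟨ cong₂ _+_ (cubeSum-comm m n (G ∘ (false ∷_))) (cubeSum-comm m n (G ∘ (true ∷_))) ⟩
  cubeSum n (λ y → cubeSum m (λ x → G (false ∷ x) y)) + cubeSum n (λ y → cubeSum m (λ x → G (true ∷ x) y))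
    ≡⟨ cubeSum-distrib-+ n _ _ ⟨
  cubeSum n (λ y → cubeSum (suc m) (λ x → G x y)) ∎
  where open ≡-Reasoning

_≟ᶜ_ : ∀ {n} (x y : Cube n) → Dec (x ≡ y)
_≟ᶜ_ = Vecₚ.≡-dec Boolₚ._≟_

δ : ∀ {n} → Cube n → Cube n → ℕ
δ x y = 𝟙 (does (x ≟ᶜ y))

cubeSum-δ : ∀ n (z : Cube n) (h : Cube n → ℕ) → cubeSum n (λ y → δ y z * h y) ≡ h z
cubeSum-δ zero [] h = ℕₚ.+-identityʳ (h [])
cubeSum-δ (suc n) (false ∷ z) h = begin
  cubeSum n (λ y → δ y z * h (false ∷ y)) + cubeSum n (λ _ → 0)
    ≡⟨ cong₂ _+_ (cubeSum-δ n z (h ∘ (false ∷_))) (cubeSum-zero n) ⟩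
  h (false ∷ z) + 0
    ≡⟨ ℕₚ.+-identityʳ _ ⟩
  h (false ∷ z) ∎
  where open ≡-Reasoning
cubeSum-δ (suc n) (true ∷ z) h =
  cong₂ _+_ (cubeSum-zero n) (cubeSum-δ n z (h ∘ (true ∷_)))

-- Fubini together with the Kronecker delta: Σₓ h (φ x) = Σₓ Σ_y δ(y, φ x) h y, and δ(y, φ x) = δ(x, ψ y).
module _ {n : ℕ} (φ ψ : Cube n → Cube n) where

  δ-transpose : (∀ x → ψ (φ x) ≡ x) → (∀ y → φ (ψ y) ≡ y) → ∀ y x → δ y (φ x) ≡ δ x (ψ y)
  δ-transpose ψ∘φ φ∘ψ y x with y ≟ᶜ φ x | x ≟ᶜ ψ y
  ... | yes _    | yes _    = refl
  ... | no _     | no _     = refl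
  ... | yes y≡φx | no x≢ψy  = contradiction (trans (sym (ψ∘φ x)) (cong ψ (sym y≡φx))) x≢ψy
  ... | no y≢φx  | yes x≡ψy = contradiction (trans (sym (φ∘ψ y)) (cong φ (sym x≡ψy))) y≢φx

  cubeSum-reindex : (∀ x → ψ (φ x) ≡ x) → (∀ y → φ (ψ y) ≡ y) →
    ∀ (h : Cube n → ℕ) → cubeSum n (h ∘ φ) ≡ cubeSum n h
  cubeSum-reindex ψ∘φ φ∘ψ h = begin
    cubeSum n (h ∘ φ)
      ≡⟨ cubeSum-cong n (λ x → cubeSum-δ n (φ x) h) ⟨
    cubeSum n (λ x → cubeSum n (λ y → δ y (φ x) * h y))
      ≡⟨ cubeSum-comm n n _ ⟩
    cubeSum n (λ y → cubeSum n (λ x → δ y (φ x) * h y))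
      ≡⟨ cubeSum-cong n (λ y → cubeSum-cong n (λ x → cong (_* h y) (δ-transpose ψ∘φ φ∘ψ y x))) ⟩
    cubeSum n (λ y → cubeSum n (λ x → δ x (ψ y) * h y))
      ≡⟨ cubeSum-cong n (λ y → cubeSum-δ n (ψ y) (λ _ → h y)) ⟩
    cubeSum n h ∎
    where open ≡-Reasoning

  cubeSum-count-injection : ∀ (P Q : Cube n → Bool) →
    (∀ x → P x ≡ true → Q (φ x) ≡ true) → (∀ x → P x ≡ true → ψ (φ x) ≡ x) →
    cubeSum n (𝟙 ∘ P) ≤ cubeSum n (𝟙 ∘ Q)
  cubeSum-count-injection P Q φ-PQ ψ∘φ = begin
    cubeSum n (𝟙 ∘ P)
      ≤⟨ cubeSum-mono-≤ n point ⟩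
    cubeSum n (λ x → cubeSum n (λ y → δ y (φ x) * (δ x (ψ y) * 𝟙 (Q y))))
      ≡⟨ cubeSum-comm n n _ ⟩
    cubeSum n (λ y → cubeSum n (λ x → δ y (φ x) * (δ x (ψ y) * 𝟙 (Q y))))
      ≤⟨ cubeSum-mono-≤ n (λ y → cubeSum-mono-≤ n (λ x → δ≤1 (y ≟ᶜ φ x))) ⟩
    cubeSum n (λ y → cubeSum n (λ x → δ x (ψ y) * 𝟙 (Q y)))
      ≡⟨ cubeSum-cong n (λ y → cubeSum-δ n (ψ y) (λ _ → 𝟙 (Q y))) ⟩
    cubeSum n (𝟙 ∘ Q) ∎
    where
    open ℕₚ.≤-Reasoning
    δ≤1 : ∀ {A : Set} (d : Dec A) {k} → 𝟙 (does d) * k ≤ k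
    δ≤1 (yes _) = ℕₚ.≤-reflexive (ℕₚ.+-identityʳ _)
    δ≤1 (no _) = z≤n
    point : ∀ x → 𝟙 (P x) ≤ cubeSum n (λ y → δ y (φ x) * (δ x (ψ y) * 𝟙 (Q y)))
    point x with P x in Px
    ... | false = z≤n
    ... | true = ℕₚ.≤-reflexive (sym (begin-equality
      cubeSum n (λ y → δ y (φ x) * (δ x (ψ y) * 𝟙 (Q y)))  ≡⟨ cubeSum-δ n (φ x) _ ⟩
      δ x (ψ (φ x)) * 𝟙 (Q (φ x))                          ≡⟨ cong₂ (λ z b → δ x z * 𝟙 b) (ψ∘φ x Px) (φ-PQ x Px) ⟩
      δ x x * 1                                             ≡⟨ cong (λ b → 𝟙 b * 1) (dec-true (x ≟ᶜ x) refl) ⟩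
      1                                                     ∎))

-- Linear algebra over 𝔽₂

open CommutativeSemigroupProperties (CommutativeRing.+-commutativeSemigroup Boolₚ.xor-∧-commutativeRing)
  using () renaming (interchange to xor-interchange)

xor-cancelʳ : ∀ a b → (a xor b) xor b ≡ a
xor-cancelʳ a b = begin
  (a xor b) xor b   ≡⟨ Boolₚ.xor-assoc a b b ⟩
  a xor (b xor b)   ≡⟨ cong (a xor_) (Boolₚ.xor-same b) ⟩
  a xor false       ≡⟨ Boolₚ.xor-identityʳ a ⟩
  a                 ∎
  where open ≡-Reasoning

⊕-cancelʳ : ∀ {n} (x v : Cube n) → (x ⊕ v) ⊕ v ≡ x
⊕-cancelʳ [] [] = refl
⊕-cancelʳ (a ∷ x) (b ∷ v) = cong₂ _∷_ (xor-cancelʳ a b) (⊕-cancelʳ x v)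

lookup-ext : ∀ {A : Set} {n} (xs ys : Vec A n) → (∀ i → lookup xs i ≡ lookup ys i) → xs ≡ ys
lookup-ext xs ys xsᵢ≡ysᵢ = begin
  xs                   ≡⟨ Vecₚ.tabulate∘lookup xs ⟨
  tabulate (lookup xs) ≡⟨ Vecₚ.tabulate-cong xsᵢ≡ysᵢ ⟩
  tabulate (lookup ys) ≡⟨ Vecₚ.tabulate∘lookup ys ⟩
  ys                   ∎
  where open ≡-Reasoning

dot-⊕ʳ : ∀ {n} (r x y : Vec Bool n) → dot r (x ⊕ y) ≡ dot r x xor dot r y
dot-⊕ʳ [] [] [] = refl
dot-⊕ʳ (a ∷ r) (b ∷ x) (c ∷ y) = begin
  (a ∧ (b xor c)) xor dot r (x ⊕ y)              ≡⟨ cong₂ _xor_ (Boolₚ.∧-distribˡ-xor a b c) (dot-⊕ʳ r x y) ⟩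
  ((a ∧ b) xor (a ∧ c)) xor (dot r x xor dot r y) ≡⟨ xor-interchange (a ∧ b) _ _ _ ⟩
  ((a ∧ b) xor dot r x) xor ((a ∧ c) xor dot r y) ∎
  where open ≡-Reasoning

map-dot-⊕ : ∀ {n k} (rows : Vec (Vec Bool n) k) (x y : Cube n) →
  map (λ r → dot r (x ⊕ y)) rows ≡ map (λ r → dot r x) rows ⊕ map (λ r → dot r y) rows
map-dot-⊕ [] x y = refl
map-dot-⊕ (r ∷ rows) x y = cong₂ _∷_ (dot-⊕ʳ r x y) (map-dot-⊕ rows x y)

·-distrib-⊕ : ∀ {n} (L : Mat n) (x y : Cube n) → L · (x ⊕ y) ≡ (L · x) ⊕ (L · y)
·-distrib-⊕ = map-dot-⊕

dot-zeroˡ : ∀ {n} (x : Vec Bool n) → dot (tabulate (λ _ → false)) x ≡ false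
dot-zeroˡ [] = refl
dot-zeroˡ (b ∷ x) = dot-zeroˡ x

dot-zeroʳ : ∀ {n} (x : Vec Bool n) → dot x (tabulate (λ _ → false)) ≡ false
dot-zeroʳ [] = refl
dot-zeroʳ (a ∷ x) = trans (cong ((a ∧ false) xor_) (dot-zeroʳ x)) (cong (_xor false) (Boolₚ.∧-zeroʳ a))

dot-eˡ : ∀ {n} (i : Fin n) (x : Vec Bool n) → dot (e i) x ≡ lookup x i
dot-eˡ zero (b ∷ x) = trans (cong (b xor_) (dot-zeroˡ x)) (Boolₚ.xor-identityʳ b)
dot-eˡ (suc i) (b ∷ x) = dot-eˡ i x

dot-eʳ : ∀ {n} (i : Fin n) (x : Vec Bool n) → dot x (e i) ≡ lookup x i
dot-eʳ zero (a ∷ x) = begin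
  (a ∧ true) xor dot x (tabulate (λ _ → false)) ≡⟨ cong₂ _xor_ (Boolₚ.∧-identityʳ a) (dot-zeroʳ x) ⟩
  a xor false                                    ≡⟨ Boolₚ.xor-identityʳ a ⟩
  a                                              ∎
  where open ≡-Reasoning
dot-eʳ (suc i) (a ∷ x) = trans (cong (_xor dot x (e i)) (Boolₚ.∧-zeroʳ a)) (dot-eʳ i x)

entry : ∀ {n} → Mat n → Fin n → Fin n → Bool
entry L j i = lookup (lookup L j) i

lookup-·-e : ∀ {n} (L : Mat n) (i j : Fin n) → lookup (L · e i) j ≡ entry L j i
lookup-·-e L i j = trans (Vecₚ.lookup-map j _ L) (dot-eʳ i (lookup L j))

idMat-· : ∀ {n} (x : Cube n) → idMat · x ≡ x
idMat-· x = lookup-ext (idMat · x) x λ i → begin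
  lookup (idMat · x) i          ≡⟨ Vecₚ.lookup-map i _ idMat ⟩
  dot (lookup (tabulate e) i) x ≡⟨ cong (λ r → dot r x) (Vecₚ.lookup∘tabulate e i) ⟩
  dot (e i) x                   ≡⟨ dot-eˡ i x ⟩
  lookup x i                    ∎
  where open ≡-Reasoning

dot-tabulate-xor : ∀ {n} (g h : Fin n → Bool) (x : Vec Bool n) →
  dot (tabulate (λ j → g j xor h j)) x ≡ dot (tabulate g) x xor dot (tabulate h) x
dot-tabulate-xor g h [] = refl
dot-tabulate-xor g h (b ∷ x) = begin
  ((g zero xor h zero) ∧ b) xor dot (tabulate (λ j → g (suc j) xor h (suc j))) x
    ≡⟨ cong₂ _xor_ (Boolₚ.∧-distribʳ-xor b (g zero) (h zero)) (dot-tabulate-xor (g ∘ suc) (h ∘ suc) x) ⟩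
  ((g zero ∧ b) xor (h zero ∧ b)) xor (dot (tabulate (g ∘ suc)) x xor dot (tabulate (h ∘ suc)) x)
    ≡⟨ xor-interchange (g zero ∧ b) _ _ _ ⟩
  dot (tabulate g) (b ∷ x) xor dot (tabulate h) (b ∷ x) ∎
  where open ≡-Reasoning

dot-tabulate-∧ : ∀ {n} a (r x : Vec Bool n) → dot (tabulate (λ j → a ∧ lookup r j)) x ≡ a ∧ dot r x
dot-tabulate-∧ false r x = dot-zeroˡ x
dot-tabulate-∧ true [] [] = refl
dot-tabulate-∧ true (b ∷ r) (c ∷ x) = cong ((b ∧ c) xor_) (dot-tabulate-∧ true r x)

dot-combination : ∀ {k n} (m : Vec Bool k) (rows : Vec (Vec Bool n) k) (x : Vec Bool n) →
  dot (tabulate (λ j → dot m (map (λ r → lookup r j) rows))) x ≡ dot m (map (λ r → dot r x) rows)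
dot-combination [] [] x = dot-zeroˡ x
dot-combination (a ∷ m) (r ∷ rows) x = begin
  dot (tabulate (λ j → (a ∧ lookup r j) xor dot m (map (λ r → lookup r j) rows))) x
    ≡⟨ dot-tabulate-xor _ _ x ⟩
  dot (tabulate (λ j → a ∧ lookup r j)) x xor dot (tabulate (λ j → dot m (map (λ r → lookup r j) rows))) x
    ≡⟨ cong₂ _xor_ (dot-tabulate-∧ a r x) (dot-combination m rows x) ⟩
  (a ∧ dot r x) xor dot m (map (λ r → dot r x) rows) ∎
  where open ≡-Reasoning

*ᴹ-· : ∀ {n} (M L : Mat n) (x : Cube n) → (M *ᴹ L) · x ≡ M · (L · x)
*ᴹ-· M L x = begin
  map (λ m → dot m x) (map (λ m → tabulate (λ j → dot m (map (λ r → lookup r j) L))) M)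
    ≡⟨ Vecₚ.map-∘ _ _ M ⟨
  map (λ m → dot (tabulate (λ j → dot m (map (λ r → lookup r j) L))) x) M
    ≡⟨ Vecₚ.map-cong (λ m → dot-combination m L x) M ⟩
  M · (L · x) ∎
  where open ≡-Reasoning

·-inverseˡ : ∀ {n} (M L : Mat n) → M *ᴹ L ≡ idMat → ∀ x → M · (L · x) ≡ x
·-inverseˡ M L ML≡I x = begin
  M · (L · x)    ≡⟨ *ᴹ-· M L x ⟨
  (M *ᴹ L) · x   ≡⟨ cong (_· x) ML≡I ⟩
  idMat · x      ≡⟨ idMat-· x ⟩
  x              ∎
  where open ≡-Reasoning

eⱼ≡1 : ∀ {n} (j : Fin n) → lookup (e j) j ≡ true
eⱼ≡1 j = trans (Vecₚ.lookup∘tabulate (λ k → does (k Finₚ.≟ j)) j) (dec-true (j Finₚ.≟ j) refl)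

cubeSum-translate : ∀ {n} (v : Cube n) (h : Cube n → ℕ) → cubeSum n (λ x → h (x ⊕ v)) ≡ cubeSum n h
cubeSum-translate v = cubeSum-reindex (_⊕ v) (_⊕ v) (λ x → ⊕-cancelʳ x v) (λ x → ⊕-cancelʳ x v)

-- 2ⁿ times the influence of f in direction v.
changes : ∀ {n} → (Cube n → Bool) → Cube n → ℕ
changes {n} f v = cubeSum n (λ x → absDiff (f (x ⊕ v)) (f x))

influenceCount≡changes : ∀ {n} (f : Cube n → Bool) (i : Fin n) → influenceCount f i ≡ changes f (e i)
influenceCount≡changes {n} f i = sum-allCube n _

influenceCount-applyLin : ∀ {n} (f : Cube n → Bool) (L M : Mat n) → M *ᴹ L ≡ idMat → L *ᴹ M ≡ idMat →
  ∀ i → influenceCount (applyLin L f) i ≡ changes f (L · e i)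
influenceCount-applyLin {n} f L M ML≡I LM≡I i = begin
  influenceCount (applyLin L f) i
    ≡⟨ sum-allCube n _ ⟩
  cubeSum n (λ x → absDiff (f (L · (x ⊕ e i))) (f (L · x)))
    ≡⟨ cubeSum-cong n (λ x → cong (λ y → absDiff (f y) (f (L · x))) (·-distrib-⊕ L x (e i))) ⟩
  cubeSum n (λ x → absDiff (f ((L · x) ⊕ (L · e i))) (f (L · x)))
    ≡⟨ cubeSum-reindex (L ·_) (M ·_) (·-inverseˡ M L ML≡I) (·-inverseˡ L M LM≡I) _ ⟩
  changes f (L · e i) ∎
  where open ≡-Reasoning

-- Monotone functions

absDiff-comm : ∀ a b → absDiff a b ≡ absDiff b a
absDiff-comm a b = cong (λ c → if c then 1 else 0) (Boolₚ.xor-comm a b)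

𝟙≤𝟙+absDiff : ∀ a b → 𝟙 a ≤ 𝟙 b + absDiff b a
𝟙≤𝟙+absDiff true true = s≤s z≤n
𝟙≤𝟙+absDiff true false = s≤s z≤n
𝟙≤𝟙+absDiff false b = z≤n

𝟙≡𝟙+absDiff : ∀ a b → b ≤b a → 𝟙 a ≡ 𝟙 b + absDiff b a
𝟙≡𝟙+absDiff true true _ = refl
𝟙≡𝟙+absDiff true false _ = refl
𝟙≡𝟙+absDiff false false _ = refl

𝟙-split : ∀ b k → 𝟙 b * k + 𝟙 (not b) * k ≡ k
𝟙-split true k = trans (ℕₚ.+-identityʳ (k + 0)) (ℕₚ.+-identityʳ k)
𝟙-split false k = ℕₚ.+-identityʳ k

not-lookup-⊕ : ∀ {n} (x v : Cube n) j → lookup v j ≡ true → not (lookup (x ⊕ v) j) ≡ lookup x j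
not-lookup-⊕ x v j vⱼ≡1 = begin
  not (lookup (x ⊕ v) j)          ≡⟨ cong not (Vecₚ.lookup-zipWith _xor_ j x v) ⟩
  not (lookup x j xor lookup v j) ≡⟨ cong (λ b → not (lookup x j xor b)) vⱼ≡1 ⟩
  not (lookup x j xor true)       ≡⟨ Boolₚ.not-distribʳ-xor (lookup x j) true ⟩
  lookup x j xor false            ≡⟨ Boolₚ.xor-identityʳ (lookup x j) ⟩
  lookup x j                      ∎
  where open ≡-Reasoning

⊕-e-≼ : ∀ {n} (x : Cube n) j → lookup x j ≡ true → (x ⊕ e j) ≼ x
⊕-e-≼ x j xⱼ≡1 i
  rewrite Vecₚ.lookup-zipWith _xor_ i x (e j) | Vecₚ.lookup∘tabulate (λ k → does (k Finₚ.≟ j)) i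
  with i Finₚ.≟ j
... | yes refl rewrite xⱼ≡1 = _
... | no _ = ≡⇒≤b (lookup x i xor false) (lookup x i) (Boolₚ.xor-identityʳ (lookup x i))
  where
  ≡⇒≤b : ∀ a b → a ≡ b → a ≤b b
  ≡⇒≤b true true _ = _
  ≡⇒≤b false b _ = _

-- The counts below are restricted to the half-cube x_j = 1 (resp. x_j = 0); for v_j = 1 the
-- translation x ↦ x ⊕ v exchanges the two halves.
module _ {n : ℕ} (f : Cube n → Bool) (j : Fin n) where

  upperChanges : Cube n → ℕ
  upperChanges v = cubeSum n (λ x → 𝟙 (lookup x j) * absDiff (f (x ⊕ v)) (f x))

  upperOnes lowerOnes : ℕ
  upperOnes = cubeSum n (λ x → 𝟙 (lookup x j) * 𝟙 (f x))
  lowerOnes = cubeSum n (λ x → 𝟙 (not (lookup x j)) * 𝟙 (f x))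

  changes≡upperChanges+upperChanges : ∀ v → lookup v j ≡ true → changes f v ≡ upperChanges v + upperChanges v
  changes≡upperChanges+upperChanges v vⱼ≡1 = begin
    changes f v
      ≡⟨ cubeSum-cong n (λ x → 𝟙-split (lookup x j) (d x)) ⟨
    cubeSum n (λ x → 𝟙 (lookup x j) * d x + lower x)
      ≡⟨ cubeSum-distrib-+ n _ _ ⟩
    upperChanges v + cubeSum n lower
      ≡⟨ cong (upperChanges v +_) (cubeSum-translate v lower) ⟨
    upperChanges v + cubeSum n (λ x → lower (x ⊕ v))
      ≡⟨ cong (upperChanges v +_) (cubeSum-cong n lower-translate) ⟩
    upperChanges v + upperChanges v ∎
    where
    open ≡-Reasoning
    d lower : Cube n → ℕ
    d x = absDiff (f (x ⊕ v)) (f x)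
    lower x = 𝟙 (not (lookup x j)) * d x
    lower-translate : ∀ x → lower (x ⊕ v) ≡ 𝟙 (lookup x j) * d x
    lower-translate x = cong₂ _*_
      (cong 𝟙 (not-lookup-⊕ x v j vⱼ≡1))
      (trans (cong (λ y → absDiff (f y) (f (x ⊕ v))) (⊕-cancelʳ x v)) (absDiff-comm (f x) (f (x ⊕ v))))

  upperOnes-translate : ∀ v → lookup v j ≡ true → cubeSum n (λ x → 𝟙 (lookup x j) * 𝟙 (f (x ⊕ v))) ≡ lowerOnes
  upperOnes-translate v vⱼ≡1 = trans (cubeSum-cong n flip-half) (cubeSum-translate v (λ x → 𝟙 (not (lookup x j)) * 𝟙 (f x)))
    where
    flip-half : ∀ x → 𝟙 (lookup x j) * 𝟙 (f (x ⊕ v)) ≡ 𝟙 (not (lookup (x ⊕ v) j)) * 𝟙 (f (x ⊕ v))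
    flip-half x = cong (λ b → 𝟙 b * 𝟙 (f (x ⊕ v)))
      (sym (not-lookup-⊕ x v j vⱼ≡1))

  upperOnes≤ : ∀ v → lookup v j ≡ true → upperOnes ≤ lowerOnes + upperChanges v
  upperOnes≤ v vⱼ≡1 = begin
    upperOnes
      ≤⟨ cubeSum-mono-≤ n (λ x → ℕₚ.*-monoʳ-≤ (𝟙 (lookup x j)) (𝟙≤𝟙+absDiff (f x) (f (x ⊕ v)))) ⟩
    cubeSum n (λ x → 𝟙 (lookup x j) * (𝟙 (f (x ⊕ v)) + absDiff (f (x ⊕ v)) (f x)))
      ≡⟨ cubeSum-cong n (λ x → ℕₚ.*-distribˡ-+ (𝟙 (lookup x j)) _ _) ⟩
    cubeSum n (λ x → 𝟙 (lookup x j) * 𝟙 (f (x ⊕ v)) + 𝟙 (lookup x j) * absDiff (f (x ⊕ v)) (f x))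
      ≡⟨ cubeSum-distrib-+ n _ _ ⟩
    cubeSum n (λ x → 𝟙 (lookup x j) * 𝟙 (f (x ⊕ v))) + upperChanges v
      ≡⟨ cong (_+ upperChanges v) (upperOnes-translate v vⱼ≡1) ⟩
    lowerOnes + upperChanges v ∎
    where open ℕₚ.≤-Reasoning

  -- For v = e j monotonicity makes the pointwise estimate behind upperOnes≤ an equality.
  upperOnes≡ : Monotone f → upperOnes ≡ lowerOnes + upperChanges (e j)
  upperOnes≡ mono = begin
    upperOnes
      ≡⟨ cubeSum-cong n exact ⟩
    cubeSum n (λ x → 𝟙 (lookup x j) * 𝟙 (f (x ⊕ e j)) + 𝟙 (lookup x j) * absDiff (f (x ⊕ e j)) (f x))
      ≡⟨ cubeSum-distrib-+ n _ _ ⟩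
    cubeSum n (λ x → 𝟙 (lookup x j) * 𝟙 (f (x ⊕ e j))) + upperChanges (e j)
      ≡⟨ cong (_+ upperChanges (e j)) (upperOnes-translate (e j) (eⱼ≡1 j)) ⟩
    lowerOnes + upperChanges (e j) ∎
    where
    open ≡-Reasoning
    exact : ∀ x → 𝟙 (lookup x j) * 𝟙 (f x)
                ≡ 𝟙 (lookup x j) * 𝟙 (f (x ⊕ e j)) + 𝟙 (lookup x j) * absDiff (f (x ⊕ e j)) (f x)
    exact x with lookup x j in xⱼ
    ... | false = refl
    ... | true = trans (cong (1 *_) (𝟙≡𝟙+absDiff (f x) (f (x ⊕ e j)) (mono (x ⊕ e j) x (⊕-e-≼ x j xⱼ))))
                       (ℕₚ.*-distribˡ-+ 1 (𝟙 (f (x ⊕ e j))) _)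

  changes-e-minimal : Monotone f → ∀ v → lookup v j ≡ true → changes f (e j) ≤ changes f v
  changes-e-minimal mono v vⱼ≡1 = begin
    changes f (e j)                         ≡⟨ changes≡upperChanges+upperChanges (e j) (eⱼ≡1 j) ⟩
    upperChanges (e j) + upperChanges (e j) ≤⟨ ℕₚ.+-mono-≤ upper≤ upper≤ ⟩
    upperChanges v + upperChanges v         ≡⟨ changes≡upperChanges+upperChanges v vⱼ≡1 ⟨
    changes f v                             ∎
    where
    open ℕₚ.≤-Reasoning
    upper≤ : upperChanges (e j) ≤ upperChanges v
    upper≤ = ℕₚ.+-cancelˡ-≤ lowerOnes _ _ (subst (_≤ lowerOnes + upperChanges v) (upperOnes≡ mono) (upperOnes≤ v vⱼ≡1))

-- Hall's condition for invertible matrices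

from-does-true : ∀ {A : Set} (a? : Dec A) → does a? ≡ true → A
from-does-true (yes a) _ = a

∧-≡-true : ∀ a b → T (a ∧ b) → a ≡ true × b ≡ true
∧-≡-true true true _ = refl , refl

neighbours : ∀ {m n} → (Fin m → Fin n → Bool) → Subset m → Subset n
neighbours R S = tabulate (λ i → does (any? (λ j → T? (lookup S j ∧ R j i))))

neighbours⁺ : ∀ {m n} (R : Fin m → Fin n → Bool) S {j i} →
  lookup S j ≡ true → R j i ≡ true → lookup (neighbours R S) i ≡ true
neighbours⁺ R S {j} {i} Sⱼ≡1 Rⱼᵢ≡1 = trans (Vecₚ.lookup∘tabulate _ i)
  (dec-true (any? (λ j → T? (lookup S j ∧ R j i))) (j , subst₂ (λ a b → T (a ∧ b)) (sym Sⱼ≡1) (sym Rⱼᵢ≡1) _))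

neighbours⁻ : ∀ {m n} (R : Fin m → Fin n → Bool) S i →
  lookup (neighbours R S) i ≡ true → ∃ λ j → lookup S j ≡ true × R j i ≡ true
neighbours⁻ R S i Nᵢ≡1
  rewrite Vecₚ.lookup∘tabulate (λ i → does (any? (λ j → T? (lookup S j ∧ R j i)))) i
  with any? (λ j → T? (lookup S j ∧ R j i)) | Nᵢ≡1
... | yes (j , t) | _ = j , ∧-≡-true (lookup S j) (R j i) t

cubeSum-⊆ : ∀ n (S : Subset n) → cubeSum n (λ x → 𝟙 (does (x ⊆? S))) ≡ 2 ^ ∣ S ∣
cubeSum-⊆ zero [] = refl
cubeSum-⊆ (suc n) (false ∷ S) = trans (cong₂ _+_ (cubeSum-⊆ n S) (cubeSum-zero n)) (ℕₚ.+-identityʳ _)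
cubeSum-⊆ (suc n) (true ∷ S) =
  trans (cong₂ _+_ (cubeSum-⊆ n S) (cubeSum-⊆ n S)) (cong (2 ^ ∣ S ∣ +_) (sym (ℕₚ.+-identityʳ _)))

2^-cancel-≤ : ∀ {a b} → 2 ^ a ≤ 2 ^ b → a ≤ b
2^-cancel-≤ {a} {b} 2ᵃ≤2ᵇ = subst₂ _≤_ (⌊log₂[2^n]⌋≡n a) (⌊log₂[2^n]⌋≡n b) (⌊log₂⌋-mono-≤ 2ᵃ≤2ᵇ)

dot-∩ : ∀ {n} (r t z : Vec Bool n) → r ⊆ t → dot r (t ∩ z) ≡ dot r z
dot-∩ [] [] [] _ = refl
dot-∩ (false ∷ r) (_ ∷ t) (_ ∷ z) r⊆t = dot-∩ r t z (drop-∷-⊆ r⊆t)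
dot-∩ (true ∷ r) (true ∷ t) (c ∷ z) r⊆t = cong (c xor_) (dot-∩ r t z (drop-∷-⊆ r⊆t))
dot-∩ (true ∷ r) (false ∷ t) (_ ∷ z) r⊆t with r⊆t here
... | ()

-- The rows of L indexed by S are supported on N = neighbours (entry L) S, and x ↦ N ∩ M x is
-- injective on subsets of S (left inverse y ↦ S ∩ L y), so 2^∣S∣ ≤ 2^∣N∣.
hall-rightInvertible : ∀ {n} (L M : Mat n) → L *ᴹ M ≡ idMat → ∀ S → ∣ S ∣ ≤ ∣ neighbours (entry L) S ∣
hall-rightInvertible {n} L M LM≡I S = 2^-cancel-≤ (subst₂ _≤_ (cubeSum-⊆ n S) (cubeSum-⊆ n N)
  (cubeSum-count-injection φ ψ (λ x → does (x ⊆? S)) (λ y → does (y ⊆? N))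
    (λ x _ → dec-true (φ x ⊆? N) (p∩q⊆p N (M · x)))
    (λ x x⊆?S → lookup-ext (ψ (φ x)) x (ψ∘φ x (from-does-true (x ⊆? S) x⊆?S)))))
  where
  N : Subset n
  N = neighbours (entry L) S
  φ ψ : Cube n → Cube n
  φ x = N ∩ (M · x)
  ψ y = S ∩ (L · y)
  row⊆N : ∀ j → lookup S j ≡ true → lookup L j ⊆ N
  row⊆N j Sⱼ≡1 {i} i∈row = Vecₚ.lookup⇒[]= i N (neighbours⁺ (entry L) S Sⱼ≡1 (Vecₚ.[]=⇒lookup i∈row))
  ψ∘φ : ∀ x → x ⊆ S → ∀ j → lookup (ψ (φ x)) j ≡ lookup x j
  ψ∘φ x x⊆S j rewrite Vecₚ.lookup-zipWith _∧_ j S (L · φ x) with lookup S j in Sⱼ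
  ... | true = begin
    lookup (L · φ x) j             ≡⟨ Vecₚ.lookup-map j _ L ⟩
    dot (lookup L j) (N ∩ (M · x)) ≡⟨ dot-∩ (lookup L j) N (M · x) (row⊆N j Sⱼ) ⟩
    dot (lookup L j) (M · x)       ≡⟨ Vecₚ.lookup-map j _ L ⟨
    lookup (L · (M · x)) j         ≡⟨ cong (λ y → lookup y j) (·-inverseˡ L M LM≡I x) ⟩
    lookup x j                     ∎
    where open ≡-Reasoning
  ... | false with lookup x j in xⱼ
  ...   | false = refl
  ...   | true = case trans (sym (Vecₚ.[]=⇒lookup (x⊆S (Vecₚ.lookup⇒[]= j x xⱼ)))) Sⱼ of λ ()

-- Weighted sums under Hall's condition

support : ∀ {k} → (Fin k → ℕ) → Subset k
support a = tabulate (λ j → 0 <ᵇ a j)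

∣tabulate∣ : ∀ {k} (g : Fin k → Bool) → ∣ tabulate g ∣ ≡ ∑[ j < k ] 𝟙 (g j)
∣tabulate∣ {zero} g = refl
∣tabulate∣ {suc k} g with g zero
... | true = cong suc (∣tabulate∣ (g ∘ suc))
... | false = ∣tabulate∣ (g ∘ suc)

∑≡∑-pred+∣support∣ : ∀ {k} (a : Fin k → ℕ) → ∑[ j < k ] a j ≡ ∑[ j < k ] (a j ∸ 1) + ∣ support a ∣
∑≡∑-pred+∣support∣ {k} a = begin
  ∑[ j < k ] a j
    ≡⟨ sum-cong-≗ (λ j → pred+positive (a j)) ⟨
  ∑[ j < k ] (a j ∸ 1 + 𝟙 (0 <ᵇ a j))
    ≡⟨ ∑-distrib-+ (λ j → a j ∸ 1) _ ⟩
  ∑[ j < k ] (a j ∸ 1) + ∑[ j < k ] 𝟙 (0 <ᵇ a j)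
    ≡⟨ cong (∑[ j < k ] (a j ∸ 1) +_) (∣tabulate∣ (λ j → 0 <ᵇ a j)) ⟨
  ∑[ j < k ] (a j ∸ 1) + ∣ support a ∣ ∎
  where
  open ≡-Reasoning
  pred+positive : ∀ m → m ∸ 1 + 𝟙 (0 <ᵇ m) ≡ m
  pred+positive zero = refl
  pred+positive (suc m) = ℕₚ.+-comm m 1

≤-∑ : ∀ {k} (a : Fin k → ℕ) j → a j ≤ ∑[ i < k ] a i
≤-∑ a zero = ℕₚ.m≤m+n (a zero) _
≤-∑ a (suc j) = ℕₚ.≤-trans (≤-∑ (a ∘ suc) j) (ℕₚ.m≤n+m _ (a zero))

-- Layer-cake induction: the rows where a is positive have at least as many neighbours, all of
-- which lie in the support of w; then subtract 1 from both weights.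
module _ {m n} (R : Fin m → Fin n → Bool) (hall : ∀ S → ∣ S ∣ ≤ ∣ neighbours R S ∣) where

  neighbours-support⊆support : ∀ (a : Fin m → ℕ) (w : Fin n → ℕ) → (∀ j i → R j i ≡ true → a j ≤ w i) →
    neighbours R (support a) ⊆ support w
  neighbours-support⊆support a w a≤w {i} i∈N with neighbours⁻ R (support a) i (Vecₚ.[]=⇒lookup i∈N)
  ... | j , aⱼ>0 , Rⱼᵢ = Vecₚ.lookup⇒[]= i (support w)
    (trans (Vecₚ.lookup∘tabulate _ i) (positive-mono (a≤w j i Rⱼᵢ) (trans (sym (Vecₚ.lookup∘tabulate _ j)) aⱼ>0)))
    where
    positive-mono : ∀ {p q} → p ≤ q → (0 <ᵇ p) ≡ true → (0 <ᵇ q) ≡ true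
    positive-mono (s≤s _) _ = refl

  ∑-≤-bounded : ∀ K (a : Fin m → ℕ) (w : Fin n → ℕ) → (∀ j → a j ≤ K) → (∀ j i → R j i ≡ true → a j ≤ w i) →
    ∑[ j < m ] a j ≤ ∑[ i < n ] w i
  ∑-≤-bounded zero a w a≤0 a≤w =
    ℕₚ.≤-trans (ℕₚ.≤-reflexive (trans (sum-cong-≗ (ℕₚ.n≤0⇒n≡0 ∘ a≤0)) (sum-replicate-zero m))) z≤n
  ∑-≤-bounded (suc K) a w a≤K a≤w = begin
    ∑[ j < m ] a j                       ≡⟨ ∑≡∑-pred+∣support∣ a ⟩
    ∑[ j < m ] (a j ∸ 1) + ∣ support a ∣ ≤⟨ ℕₚ.+-mono-≤ pred-≤ support-≤ ⟩
    ∑[ i < n ] (w i ∸ 1) + ∣ support w ∣ ≡⟨ ∑≡∑-pred+∣support∣ w ⟨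
    ∑[ i < n ] w i                       ∎
    where
    open ℕₚ.≤-Reasoning
    pred-≤ : ∑[ j < m ] (a j ∸ 1) ≤ ∑[ i < n ] (w i ∸ 1)
    pred-≤ = ∑-≤-bounded K (λ j → a j ∸ 1) (λ i → w i ∸ 1)
      (λ j → ℕₚ.∸-monoˡ-≤ 1 (a≤K j)) (λ j i Rⱼᵢ → ℕₚ.∸-monoˡ-≤ 1 (a≤w j i Rⱼᵢ))
    support-≤ : ∣ support a ∣ ≤ ∣ support w ∣
    support-≤ = ℕₚ.≤-trans (hall (support a)) (p⊆q⇒∣p∣≤∣q∣ (neighbours-support⊆support a w a≤w))

  ∑-≤-Hall : ∀ (a : Fin m → ℕ) (w : Fin n → ℕ) → (∀ j i → R j i ≡ true → a j ≤ w i) →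
    ∑[ j < m ] a j ≤ ∑[ i < n ] w i
  ∑-≤-Hall a w = ∑-≤-bounded (∑[ j < m ] a j) a w (≤-∑ a)

∑influenceCount-≤-applyLin : ∀ {n} (f : Cube n → Bool) → Monotone f → (L : Mat n) → InGL L →
  ∑[ j < n ] influenceCount f j ≤ ∑[ i < n ] influenceCount (applyLin L f) i
∑influenceCount-≤-applyLin f mono L (M , ML≡I , LM≡I) = subst₂ _≤_
  (sum-cong-≗ (λ j → sym (influenceCount≡changes f j)))
  (sum-cong-≗ (λ i → sym (influenceCount-applyLin f L M ML≡I LM≡I i)))
  (∑-≤-Hall (entry L) (hall-rightInvertible L M LM≡I) (λ j → changes f (e j)) (λ i → changes f (L · e i))
    (λ j i Lⱼᵢ≡1 → changes-e-minimal f j mono (L · e i) (trans (lookup-·-e L i j) Lⱼᵢ≡1)))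

mkℚᵘ-+ : ∀ p q d → mkℚᵘ (ℤ.+ p) d ℚ.+ mkℚᵘ (ℤ.+ q) d ≃ mkℚᵘ (ℤ.+ (p + q)) d
mkℚᵘ-+ p q d = *≡* (begin
  (ℤ.+ p ℤ.* ℤ.+ s ℤ.+ ℤ.+ q ℤ.* ℤ.+ s) ℤ.* ℤ.+ s
    ≡⟨ cong (ℤ._* ℤ.+ s) (cong₂ ℤ._+_ (ℤₚ.pos-* p s) (ℤₚ.pos-* q s)) ⟨
  (ℤ.+ (p * s) ℤ.+ ℤ.+ (q * s)) ℤ.* ℤ.+ s
    ≡⟨ cong (ℤ._* ℤ.+ s) (ℤₚ.pos-+ (p * s) (q * s)) ⟨
  ℤ.+ (p * s + q * s) ℤ.* ℤ.+ s
    ≡⟨ ℤₚ.pos-* (p * s + q * s) s ⟨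
  ℤ.+ ((p * s + q * s) * s)
    ≡⟨ cong (λ k → ℤ.+ (k * s)) (ℕₚ.*-distribʳ-+ s p q) ⟨
  ℤ.+ ((p + q) * s * s)
    ≡⟨ cong ℤ.+_ (ℕₚ.*-assoc (p + q) s s) ⟩
  ℤ.+ ((p + q) * (s * s))
    ≡⟨ ℤₚ.pos-* (p + q) (s * s) ⟩
  ℤ.+ (p + q) ℤ.* ℤ.+ (s * s) ∎)
  where
  open ≡-Reasoning
  s = suc d

mkℚᵘ-mono-≤ : ∀ d {p q} → p ≤ q → mkℚᵘ (ℤ.+ p) d ℚ.≤ mkℚᵘ (ℤ.+ q) d
mkℚᵘ-mono-≤ d {p} {q} p≤q =
  *≤* (subst₂ ℤ._≤_ (ℤₚ.pos-* p (suc d)) (ℤₚ.pos-* q (suc d)) (ℤ.+≤+ (ℕₚ.*-monoˡ-≤ (suc d) p≤q)))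

foldr-mkℚᵘ : ∀ {k} d (c : Fin k → ℕ) →
  foldr _ ℚ._+_ 0ℚᵘ (tabulate (λ i → mkℚᵘ (ℤ.+ c i) d)) ≃ mkℚᵘ (ℤ.+ ∑[ i < k ] c i) d
foldr-mkℚᵘ {zero} d c = *≡* refl
foldr-mkℚᵘ {suc k} d c = ℚₚ.≃-trans (ℚₚ.+-congʳ (mkℚᵘ (ℤ.+ c zero) d) (foldr-mkℚᵘ d (c ∘ suc))) (mkℚᵘ-+ (c zero) _ d)

totalInfluence≃ : ∀ {n} (f : Cube n → Bool) →
  totalInfluence f ≃ mkℚᵘ (ℤ.+ ∑[ i < n ] influenceCount f i) (2 ^ n ∸ 1)
totalInfluence≃ {n} f =
  subst (λ qs → foldr _ ℚ._+_ 0ℚᵘ qs ≃ mkℚᵘ (ℤ.+ ∑[ i < n ] influenceCount f i) (2 ^ n ∸ 1))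
    (Vecₚ.tabulate-∘ (influence f) (λ i → i)) (foldr-mkℚᵘ (2 ^ n ∸ 1) (influenceCount f))

mainTheorem1 : (n : ℕ) → .{{_ : NonZero n}} → (f : Cube n → Bool) → Monotone f →
    (L : Mat n) → InGL L → totalInfluence f ℚ.≤ totalInfluence (applyLin L f)
mainTheorem1 n f mono L L∈GL = begin
  totalInfluence f
    ≃⟨ totalInfluence≃ f ⟩
  mkℚᵘ (ℤ.+ ∑[ j < n ] influenceCount f j) (2 ^ n ∸ 1)
    ≤⟨ mkℚᵘ-mono-≤ (2 ^ n ∸ 1) (∑influenceCount-≤-applyLin f mono L L∈GL) ⟩
  mkℚᵘ (ℤ.+ ∑[ i < n ] influenceCount (applyLin L f) i) (2 ^ n ∸ 1)
    ≃⟨ totalInfluence≃ (applyLin L f) ⟨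
  totalInfluence (applyLin L f) ∎
  where open ℚₚ.≤-Reasoning
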